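{- Let $n\geq 1$ and $r\geq 0$ be integers, let $p$ be a prime, and let $L_n^{\langle r\rangle}(x)=\sum_{j=0}^{n}\binom{n-j+r}{n-j}\frac{x^j}{j!}$. (i) If $p$ divides $n$, then $L_n^{\langle r\rangle}(x)$ is $p$-Coleman integral if and only if $\binom{n+r}{r}\not\equiv 0\pmod p$. (ii) If $\mathrm{ord}_p(n)>\mathrm{ord}_p(r!)$, then $L_n^{\langle r\rangle}(x)$ is $p$-Coleman integral.
   Context: $\mathrm{ord}_p$ is the $p$-adic valuation. Pivotal indices: write $n=b_1p^{e_1}+\cdots+b_sp^{e_s}$ with $0<b_i<p$ and $e_1>\cdots>e_s\geq 0$; the pivotal indices associated to $(n,p)$ are $k_i=b_1p^{e_1}+\cdots+b_ip^{e_i}$, $i=0,\dots,s$ ($k_0=0$). A polynomial $f=\sum_{j=0}^n a_j x^j/j!\in\mathbb{Q}[x]$ of degree $n$ is $p$-Coleman integral if $\mathrm{ord}_p(a_j)\ge 0$ for all $j$ and $\mathrm{ord}_p(a_{k_i})=0$ for all $i=0,\dots,s$. -}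

module Defs where

open import Data.Nat using (ℕ; zero; suc; _+_; _*_; _∸_; _^_; _≤_; _<_; NonZero)
open import Data.Nat.Properties using (m^n≢0)
open import Data.Nat.DivMod using (_/_; _%_)
open import Data.Nat.Divisibility using (_∣_)
open import Data.Nat using (_!)
open import Data.Nat.Combinatorics using (_C_)
open import Data.Integer using (+_; ∣_∣)
open import Data.Rational using (ℚ; ↥_; ↧ₙ_; 0ℚ)
import Data.Rational as ℚ
open import Data.List using (List; map; filter; scanl; downFrom)
open import Data.List.Membership.Propositional using (_∈_)
open import Data.Product using (Σ; _×_)
open import Relation.Nullary using (¬_)
open import Relation.Binary.PropositionalEquality using (_≡_)

OrdIs : ℕ → ℕ → ℕ → Set
OrdIs p m k = (p ^ k ∣ m) × ¬ (p ^ suc k ∣ m)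

-- For a rational q = a/b in lowest terms (b > 0):
-- ord_p(q) ≥ 0  iff  p ∤ b   (since gcd(a,b)=1)
OrdNonneg : ℕ → ℚ → Set
OrdNonneg p q = ¬ (p ∣ ↧ₙ q)

-- ord_p(q) = 0  iff  p ∤ a  and  p ∤ b  (for q = 0, p ∣ 0 so this fails, as ord_p(0) = ∞)
OrdZero : ℕ → ℚ → Set
OrdZero p q = ¬ (p ∣ ∣ ↥ q ∣) × ¬ (p ∣ ↧ₙ q)

digit : (p : ℕ) .{{_ : NonZero p}} → ℕ → ℕ → ℕ
digit p n e = (n / (p ^ e)) {{m^n≢0 p e}} % p

-- the nonzero terms b_i p^{e_i} of the base-p expansion of n, with e_1 > ... > e_s
-- (positions e ≤ n suffice since p ≥ 2 gives p^e > n for e > n)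
expansionTerms : (p : ℕ) .{{_ : NonZero p}} → ℕ → List ℕ
expansionTerms p n =
  filter (λ t → ¬? (t Data.Nat.≟ 0)) (map (λ e → digit p n e * p ^ e) (downFrom (suc n)))
  where open import Relation.Nullary using (¬?)

pivotalIndices : (p : ℕ) .{{_ : NonZero p}} → ℕ → List ℕ
pivotalIndices p n = scanl _+_ 0 (expansionTerms p n)

-- f = Σ_{j=0}^n a_j x^j / j!, given by its coefficient sequence a (only a_0..a_n used),
-- of degree n (a_n ≠ 0), is p-Coleman integral
ColemanIntegral : (p : ℕ) .{{_ : NonZero p}} → (n : ℕ) → (ℕ → ℚ) → Set
ColemanIntegral p n a =
  ¬ (a n ≡ 0ℚ) ×
  (∀ j → j ≤ n → OrdNonneg p (a j)) ×
  (∀ k → k ∈ pivotalIndices p n → OrdZero p (a k))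

laguerreCoeff : ℕ → ℕ → ℕ → ℚ
laguerreCoeff n r j = (+ ((n ∸ j + r) C (n ∸ j))) ℚ./ 1

{-# OPTIONS --safe #-}
module Submission where

-- The coefficients C(n − j + r, n − j) of L_n^⟨r⟩ are integers, so p-Coleman integrality only
-- asks that p ∤ C(n − k + r, r) at each pivotal index k, and there n − k is n mod p^e for some e.
-- By Kummer's theorem, a consequence of one step of Lucas's theorem
-- C(a₁p + a₀, b₁p + b₀) ≡ C(a₀, b₀) C(a₁, b₁) (mod p), p ∤ C(m + r, r) iff adding m and r in
-- base p produces no carry. Reducing n mod p^e only deletes digits, hence carries, so the
-- condition at k = 0, p ∤ C(n + r, r), implies it at every pivotal index; this is (i).
-- In (ii), p^(k+1) ∤ r! forces r < p^(k+1) while p^(k+1) ∣ n, so n and r have their nonzero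
-- digits in disjoint positions and no carry occurs.

open import Defs
open import Data.Nat
open import Data.Nat.Properties
open import Data.Nat.DivMod
open import Data.Nat.Divisibility
open import Data.Nat.Primality using (Prime; prime⇒nonZero; prime⇒nonTrivial; euclidsLemma)
open import Data.Nat.Combinatorics
  using (_C_; nCk+nC[k+1]≡[n+1]C[k+1]; nCk≡n!/k![n-k]!; k>n⇒nCk≡0; k![n∸k]!∣n!; nCk≡nC[n∸k]; nCn≡1)
open import Data.Nat.Induction using (<-wellFounded)
import Data.Nat.Coprimality as Coprime
open import Data.Integer using (∣_∣)
import Data.Integer as ℤ
open import Data.Rational using (mkℚ; ↥_; ↧ₙ_; 0ℚ)
import Data.Rational as ℚ
open import Data.Rational.Properties using (normalize-coprime)
open import Data.List using ([]; _∷_; map; filter; scanl; downFrom)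
open import Data.List.Membership.Propositional using (_∈_)
open import Data.List.Relation.Unary.Any using (here; there)
open import Data.Product using (Σ; ∃-syntax; _×_; _,_; proj₁; map₂)
open import Data.Sum using (inj₁; inj₂; [_,_]′)
open import Function.Base using (_∘_; _$_)
open import Algebra.Properties.CommutativeSemigroup +-commutativeSemigroup
  using () renaming (interchange to +-interchange)
open import Function.Bundles using (_⇔_; mk⇔)
open import Induction.WellFounded using (Acc; acc)
open import Relation.Binary.Bundles using (Setoid)
open import Relation.Binary.PropositionalEquality
open import Relation.Nullary using (¬_; ¬?; yes; no)
open import Relation.Nullary.Negation using (contradiction)

infix 4 _≡[_]_
record _≡[_]_ (m d n : ℕ) .{{_ : NonZero d}} : Set where
  constructor mod≡
  field %-≡ : m % d ≡ n % d

module _ {d : ℕ} .{{_ : NonZero d}} where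

  ≡[]-refl : ∀ {m} → m ≡[ d ] m
  ≡[]-refl = mod≡ refl

  ≡⇒≡[] : ∀ {m n} → m ≡ n → m ≡[ d ] n
  ≡⇒≡[] refl = ≡[]-refl

  ≡[]-sym : ∀ {m n} → m ≡[ d ] n → n ≡[ d ] m
  ≡[]-sym (mod≡ e) = mod≡ (sym e)

  ≡[]-setoid : Setoid _ _
  ≡[]-setoid = record
    { _≈_ = _≡[ d ]_
    ; isEquivalence = record
      { refl  = ≡[]-refl
      ; sym   = ≡[]-sym
      ; trans = λ (mod≡ e) (mod≡ f) → mod≡ (trans e f)
      }
    }

  +-cong-≡[] : ∀ {m m′ n n′} → m ≡[ d ] m′ → n ≡[ d ] n′ → m + n ≡[ d ] m′ + n′
  +-cong-≡[] {m} {m′} {n} {n′} (mod≡ e) (mod≡ f) = mod≡ (begin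
    (m + n) % d              ≡⟨ %-distribˡ-+ m n d ⟩
    (m % d + n % d) % d      ≡⟨ cong₂ (λ x y → (x + y) % d) e f ⟩
    (m′ % d + n′ % d) % d    ≡⟨ %-distribˡ-+ m′ n′ d ⟨
    (m′ + n′) % d            ∎)
    where open ≡-Reasoning

  ∣⇒≡[]0 : ∀ {m} → d ∣ m → m ≡[ d ] 0
  ∣⇒≡[]0 {m} d∣m = mod≡ (trans (n∣m⇒m%n≡0 m d d∣m) (sym (m<n⇒m%n≡m (>-nonZero⁻¹ d))))

  ∣-resp-≡[] : ∀ {m n} → m ≡[ d ] n → d ∣ m → d ∣ n
  ∣-resp-≡[] {m} {n} (mod≡ e) d∣m = m%n≡0⇒n∣m n d (trans (sym e) (n∣m⇒m%n≡0 m d d∣m))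

pascal : ∀ n k .{{_ : NonZero k}} → suc n C k ≡ n C pred k + n C k
pascal n (suc k) = sym (nCk+nC[k+1]≡[n+1]C[k+1] n k)

[m+n]Cm≡[m+n]Cn : ∀ m n → (m + n) C m ≡ (m + n) C n
[m+n]Cm≡[m+n]Cn m n = trans (nCk≡nC[n∸k] (m≤m+n m n)) (cong ((m + n) C_) (m+n∸m≡n m n))

nCk*[k!*[n∸k]!]≡n! : ∀ {n k} → k ≤ n → (n C k) * (k ! * (n ∸ k) !) ≡ n !
nCk*[k!*[n∸k]!]≡n! {n} {k} k≤n = begin
  (n C k) * (k ! * (n ∸ k) !)                       ≡⟨ cong (_* (k ! * (n ∸ k) !)) (nCk≡n!/k![n-k]! k≤n) ⟩
  (n ! / (k ! * (n ∸ k) !)) * (k ! * (n ∸ k) !)     ≡⟨ m/n*n≡m (k![n∸k]!∣n! k≤n) ⟩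
  n !                                               ∎
  where
  open ≡-Reasoning
  instance _ = k !* (n ∸ k) !≢0

n∣n! : ∀ n .{{_ : NonZero n}} → n ∣ n !
n∣n! (suc n) = m∣m*n (n !)

m∤n!⇒n<m : ∀ {m} n .{{_ : NonZero m}} → ¬ m ∣ n ! → n < m
m∤n!⇒n<m {m} n m∤n! = ≰⇒> λ m≤n → m∤n! (∣-trans (n∣n! m) (m≤n⇒m!∣n! m≤n))

lastDigits : (p : ℕ) .{{_ : NonZero p}} → ℕ → ℕ → ℕ
lastDigits p e n = (n % p ^ e) {{m^n≢0 p e}}

NoCarry : (p : ℕ) .{{_ : NonZero p}} → ℕ → ℕ → Set
NoCarry p a b = ∀ e → digit p a e + digit p b e < p

module _ (p : ℕ) .{{_ : NonZero p}} where

  digit-zero : ∀ n → digit p n 0 ≡ n % p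
  digit-zero n = cong (_% p) (n/1≡n n)

  digit-suc : ∀ n e → digit p n (suc e) ≡ digit p (n / p) e
  digit-suc n e = cong (_% p) (sym (m/n/o≡m/[n*o] n p (p ^ e)))
    where instance
      _ = m^n≢0 p e
      _ = m^n≢0 p (suc e)

  digit-of-0 : ∀ e → digit p 0 e ≡ 0
  digit-of-0 e = trans (cong (_% p) (0/n≡0 (p ^ e))) (m<n⇒m%n≡m (>-nonZero⁻¹ p))
    where instance _ = m^n≢0 p e

  digit-lastDigits-≤ : ∀ n e f → digit p (lastDigits p e n) f ≤ digit p n f
  digit-lastDigits-≤ n zero    f       = begin
    digit p (n % 1) f  ≡⟨ cong (λ m → digit p m f) (n%1≡0 n) ⟩
    digit p 0 f        ≡⟨ digit-of-0 f ⟩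
    0                  ≤⟨ z≤n ⟩
    digit p n f        ∎
    where open ≤-Reasoning
  digit-lastDigits-≤ n (suc e) zero    = ≤-reflexive (begin
    digit p (n % p ^ suc e) 0  ≡⟨ digit-zero _ ⟩
    n % (p * p ^ e) % p        ≡⟨ m∣n⇒o%n%m≡o%m p (p * p ^ e) n (m∣m*n (p ^ e)) ⟩
    n % p                      ≡⟨ digit-zero n ⟨
    digit p n 0                ∎)
    where
    open ≡-Reasoning
    instance _ = m^n≢0 p (suc e)
  digit-lastDigits-≤ n (suc e) (suc f) = begin
    digit p (n % p ^ suc e) (suc f)    ≡⟨ digit-suc _ f ⟩
    digit p (n % (p * p ^ e) / p) f    ≡⟨ cong (λ m → digit p m f) n%[p*q]/p≡n/p%q ⟩
    digit p (n / p % p ^ e) f          ≤⟨ digit-lastDigits-≤ (n / p) e f ⟩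
    digit p (n / p) f                  ≡⟨ digit-suc n f ⟨
    digit p n (suc f)                  ∎
    where
    open ≤-Reasoning
    instance
      _ = m^n≢0 p e
      _ = m^n≢0 p (suc e)
      _ = m*n≢0 (p ^ e) p
    n%[p*q]/p≡n/p%q : n % (p * p ^ e) / p ≡ n / p % p ^ e
    n%[p*q]/p≡n/p%q = trans (cong (_/ p) (%-congʳ (*-comm p (p ^ e)))) (m%[n*o]/o≡m/o%n n (p ^ e) p)

  lastDigits-suc : ∀ n e → lastDigits p (suc e) n ≡ digit p n e * p ^ e + lastDigits p e n
  lastDigits-suc n e = sym $ begin
    n / q % p * q + n % q          ≡⟨ cong (_+ n % q) (m%n*o≡m*o%[n*o] (n / q) p q) ⟩
    n / q * q % (p * q) + n % q    ≡⟨ [m*n+o]%[p*n]≡[m*n]%[p*n]+o (n / q) p (m%n<n n q) ⟨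
    (n / q * q + n % q) % (p * q)  ≡⟨ %-congˡ {o = p * q} (trans (m≡m%n+[m/n]*n n q) (+-comm (n % q) _)) ⟨
    n % (p * q)                    ∎
    where
    open ≡-Reasoning
    q = p ^ e
    instance
      _ = m^n≢0 p e
      _ = m^n≢0 p (suc e)

  digit-of-multiple : ∀ {n k e} → p ^ k ∣ n → e < k → digit p n e ≡ 0
  digit-of-multiple {n} {suc k} {zero}  p^k∣n _ =
    trans (digit-zero n) (n∣m⇒m%n≡0 n p (∣-trans (m∣m*n (p ^ k)) p^k∣n))
  digit-of-multiple {n} {suc k} {suc e} p^k∣n (s<s e<k) =
    trans (digit-suc n e) (digit-of-multiple (m*n∣o⇒n∣o/m p (p ^ k) p^k∣n) e<k)

  digit-of-small : ∀ {n k e} → n < p ^ k → k ≤ e → digit p n e ≡ 0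
  digit-of-small {n} {k} {e} n<p^k k≤e =
    trans (cong (_% p) (m<n⇒m/n≡0 (<-≤-trans n<p^k (^-monoʳ-≤ p k≤e)))) (digit-of-0 0)
    where instance _ = m^n≢0 p e

  noCarry⇒%<p : ∀ {a b} → NoCarry p a b → a % p + b % p < p
  noCarry⇒%<p {a} {b} nc = subst (_< p) (cong₂ _+_ (digit-zero a) (digit-zero b)) (nc 0)

  noCarry-/ : ∀ {a b} → NoCarry p a b → NoCarry p (a / p) (b / p)
  noCarry-/ {a} {b} nc e = subst (_< p) (cong₂ _+_ (digit-suc a e) (digit-suc b e)) (nc (suc e))

  noCarry-lastDigits : ∀ {n r} e → NoCarry p n r → NoCarry p (lastDigits p e n) r
  noCarry-lastDigits {n} {r} e nc f = ≤-<-trans (+-monoˡ-≤ (digit p r f) (digit-lastDigits-≤ n e f)) (nc f)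

  noCarry-separated : ∀ {n r} k → p ^ k ∣ n → r < p ^ k → NoCarry p n r
  noCarry-separated {n} {r} k p^k∣n r<p^k e with e <? k
  ... | yes e<k = subst (λ x → x + digit p r e < p) (sym (digit-of-multiple p^k∣n e<k)) (m%n<n _ p)
  ... | no  e≮k = subst (λ y → digit p n e + y < p) (sym (digit-of-small r<p^k (≮⇒≥ e≮k)))
                    (subst (_< p) (sym (+-identityʳ _)) (m%n<n _ p))

n<m^n : ∀ {m} n → 1 < m → n < m ^ n
n<m^n zero    _   = s≤s z≤n
n<m^n {m} (suc n) 1<m = begin-strict
  suc n          <⟨ m<m+n (suc n) (s≤s z≤n) ⟩
  suc n + suc n  ≡⟨ cong (suc n +_) (+-identityʳ (suc n)) ⟨
  2 * suc n      ≤⟨ *-mono-≤ 1<m (n<m^n n 1<m) ⟩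
  m * m ^ n      ∎
  where open ≤-Reasoning

head∈scanl : ∀ {A B : Set} (f : A → B → A) s xs → s ∈ scanl f s xs
head∈scanl f s []      = here refl
head∈scanl f s (_ ∷ _) = here refl

∈-scanl-+-filter-nonzero : ∀ {k} xs s →
  k ∈ scanl _+_ s (filter (λ t → ¬? (t ≟ 0)) xs) → k ∈ scanl _+_ s xs
∈-scanl-+-filter-nonzero []           s k∈         = k∈
∈-scanl-+-filter-nonzero (zero ∷ xs)  s k∈         =
  there (subst (λ a → _ ∈ scanl _+_ a xs) (sym (+-identityʳ s)) (∈-scanl-+-filter-nonzero xs s k∈))
∈-scanl-+-filter-nonzero (suc _ ∷ _)  s (here k≡s) = here k≡s
∈-scanl-+-filter-nonzero (x@(suc _) ∷ xs) s (there k∈) = there (∈-scanl-+-filter-nonzero xs (s + x) k∈)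

module _ (p : ℕ) .{{_ : NonZero p}} (n : ℕ) where

  private
    ∈-scanl-digits : ∀ {k} e s → s + lastDigits p e n ≡ n →
      k ∈ scanl _+_ s (map (λ f → digit p n f * p ^ f) (downFrom e)) →
      ∃[ f ] k + lastDigits p f n ≡ n
    ∈-scanl-digits zero    s eq (here refl) = zero , eq
    ∈-scanl-digits (suc e) s eq (here refl) = suc e , eq
    ∈-scanl-digits (suc e) s eq (there k∈) = ∈-scanl-digits e (s + digit p n e * p ^ e)
      (trans (+-assoc s _ _) (trans (cong (s +_) (sym (lastDigits-suc p n e))) eq)) k∈

  ∈-pivotalIndices⇒∸≡lastDigits : ∀ {k} → 1 < p → k ∈ pivotalIndices p n →
    ∃[ e ] n ∸ k ≡ lastDigits p e n
  ∈-pivotalIndices⇒∸≡lastDigits {k} 1<p k∈ =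
    map₂ (λ k+m≡n → trans (cong (_∸ k) (sym k+m≡n)) (m+n∸m≡n k _))
      (∈-scanl-digits (suc n) 0 lastDigits[1+n]≡n
        (∈-scanl-+-filter-nonzero (map (λ f → digit p n f * p ^ f) (downFrom (suc n))) 0 k∈))
    where
    lastDigits[1+n]≡n : lastDigits p (suc n) n ≡ n
    lastDigits[1+n]≡n = m<n⇒m%n≡m {{m^n≢0 p (suc n)}} (<-≤-trans (n<m^n n 1<p) (^-monoʳ-≤ p (n≤1+n n)))

+m/1≡mkℚ : ∀ m → (ℤ.+ m) ℚ./ 1 ≡ mkℚ (ℤ.+ m) 0 (Coprime.sym (Coprime.1-coprimeTo m))
+m/1≡mkℚ m = normalize-coprime (Coprime.sym (Coprime.1-coprimeTo m))

laguerreCoeff-numerator : ∀ n r j → ∣ ↥ laguerreCoeff n r j ∣ ≡ (n ∸ j + r) C (n ∸ j)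
laguerreCoeff-numerator n r j = cong (∣_∣ ∘ ↥_) (+m/1≡mkℚ ((n ∸ j + r) C (n ∸ j)))

laguerreCoeff-denominator : ∀ n r j → ↧ₙ laguerreCoeff n r j ≡ 1
laguerreCoeff-denominator n r j = cong ↧ₙ_ (+m/1≡mkℚ ((n ∸ j + r) C (n ∸ j)))

module _ {p : ℕ} (p-prime : Prime p) where

  private
    instance
      p≢0 : NonZero p
      p≢0 = prime⇒nonZero p-prime
    1<p : 1 < p
    1<p = nonTrivial⇒n>1 p {{prime⇒nonTrivial p-prime}}

  p∤1 : ¬ p ∣ 1
  p∤1 p∣1 = nonTrivial⇒≢1 {{prime⇒nonTrivial p-prime}} (∣1⇒≡1 p∣1)

  m<p⇒p∤m! : ∀ {m} → m < p → ¬ p ∣ m !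
  m<p⇒p∤m! {zero}  _   = p∤1
  m<p⇒p∤m! {suc m} m<p p∣m! with euclidsLemma (suc m) (m !) p-prime p∣m!
  ... | inj₁ p∣1+m = <⇒≱ m<p (∣⇒≤ p∣1+m)
  ... | inj₂ p∣m!  = m<p⇒p∤m! (<-trans (n<1+n m) m<p) p∣m!

  n<p⇒p∤nCk : ∀ {n k} → n < p → k ≤ n → ¬ p ∣ n C k
  n<p⇒p∤nCk {n} {k} n<p k≤n p∣nCk =
    m<p⇒p∤m! n<p (subst (p ∣_) (nCk*[k!*[n∸k]!]≡n! k≤n) (∣-trans p∣nCk (m∣m*n _)))

  p∣pCk : ∀ {k} → 0 < k → k < p → p ∣ p C k
  p∣pCk {k} 0<k k<p with euclidsLemma (p C k) (k ! * (p ∸ k) !) p-prime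
    (subst (p ∣_) (sym (nCk*[k!*[n∸k]!]≡n! (<⇒≤ k<p))) (n∣n! p))
  ... | inj₁ p∣pCk = p∣pCk
  ... | inj₂ p∣k!*[p∸k]! with euclidsLemma (k !) ((p ∸ k) !) p-prime p∣k!*[p∸k]!
  ...   | inj₁ p∣k!     = contradiction p∣k! (m<p⇒p∤m! k<p)
  ...   | inj₂ p∣[p∸k]! = contradiction p∣[p∸k]! (m<p⇒p∤m! (∸-monoʳ-< 0<k (<⇒≤ k<p)))

  module _ where
    open import Relation.Binary.Reasoning.Setoid (≡[]-setoid {p})

    -- Coefficientwise, (1 + X)^(m+p) ≡ (1 + X)^m (1 + X^p) (mod p).
    [m+p]Cn≡mCn : ∀ m n → n < p → (m + p) C n ≡[ p ] m C n
    [m+p]Cn≡mCn zero    zero    _   = ≡[]-refl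
    [m+p]Cn≡mCn zero    (suc n) n<p = ∣⇒≡[]0 (p∣pCk z<s n<p)
    [m+p]Cn≡mCn (suc m) zero    _   = ≡[]-refl
    [m+p]Cn≡mCn (suc m) (suc n) n<p = begin
      suc (m + p) C suc n            ≡⟨ pascal (m + p) (suc n) ⟩
      (m + p) C n + (m + p) C suc n  ≈⟨ +-cong-≡[] ([m+p]Cn≡mCn m n (<-trans (n<1+n n) n<p))
                                                    ([m+p]Cn≡mCn m (suc n) n<p) ⟩
      m C n + m C suc n              ≡⟨ pascal m (suc n) ⟨
      suc m C suc n                  ∎

    [m+p]C[n+p]≡mC[n+p]+mCn : ∀ m n → (m + p) C (n + p) ≡[ p ] m C (n + p) + m C n
    [m+p]C[n+p]≡mC[n+p]+mCn zero    zero    = begin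
      p C p      ≡⟨ nCn≡1 p ⟩
      1          ≡⟨ cong (_+ 1) (k>n⇒nCk≡0 (>-nonZero⁻¹ p)) ⟨
      0 C p + 1  ∎
    [m+p]C[n+p]≡mC[n+p]+mCn zero    (suc n) = ≡⇒≡[] (k>n⇒nCk≡0 (m<n+m p z<s))
    [m+p]C[n+p]≡mC[n+p]+mCn (suc m) zero    = begin
      suc (m + p) C p                 ≡⟨ pascal (m + p) p ⟩
      (m + p) C pred p + (m + p) C p  ≈⟨ +-cong-≡[] ([m+p]Cn≡mCn m (pred p) (≤-reflexive (suc-pred p)))
                                                     ([m+p]C[n+p]≡mC[n+p]+mCn m zero) ⟩
      m C pred p + (m C p + 1)        ≡⟨ +-assoc (m C pred p) (m C p) 1 ⟨
      m C pred p + m C p + 1          ≡⟨ cong (_+ 1) (pascal m p) ⟨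
      suc m C p + 1                   ∎
    [m+p]C[n+p]≡mC[n+p]+mCn (suc m) (suc n) = begin
      suc (m + p) C suc (n + p)                              ≡⟨ pascal (m + p) (suc (n + p)) ⟩
      (m + p) C (n + p) + (m + p) C (suc n + p)              ≈⟨ +-cong-≡[] ([m+p]C[n+p]≡mC[n+p]+mCn m n)
                                                                           ([m+p]C[n+p]≡mC[n+p]+mCn m (suc n)) ⟩
      (m C (n + p) + m C n) + (m C (suc n + p) + m C suc n)  ≡⟨ +-interchange (m C (n + p)) _ _ _ ⟩
      (m C (n + p) + m C (suc n + p)) + (m C n + m C suc n)  ≡⟨ cong₂ _+_ (pascal m (suc n + p)) (pascal m (suc n)) ⟨
      suc m C (suc n + p) + suc m C suc n                    ∎

    lucas-digits : ∀ {a₀ b₀} → a₀ < p → b₀ < p → ∀ a₁ b₁ →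
      (a₁ * p + a₀) C (b₁ * p + b₀) ≡[ p ] (a₀ C b₀) * (a₁ C b₁)
    lucas-digits {a₀} {b₀} a₀<p b₀<p = go
      where
      shift : ∀ x y → suc x * p + y ≡ (x * p + y) + p
      shift x y = trans (+-assoc p (x * p) y) (+-comm p (x * p + y))
      go : ∀ a₁ b₁ → (a₁ * p + a₀) C (b₁ * p + b₀) ≡[ p ] (a₀ C b₀) * (a₁ C b₁)
      go zero     zero     = ≡⇒≡[] (sym (*-identityʳ (a₀ C b₀)))
      go zero     (suc b₁) = begin
        a₀ C (suc b₁ * p + b₀)  ≡⟨ k>n⇒nCk≡0 (<-≤-trans a₀<p (≤-trans (m≤m+n p (b₁ * p)) (m≤m+n _ b₀))) ⟩
        0                       ≡⟨ *-zeroʳ (a₀ C b₀) ⟨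
        (a₀ C b₀) * 0           ∎
      go (suc a₁) zero     = begin
        (suc a₁ * p + a₀) C b₀    ≡⟨ cong (_C b₀) (shift a₁ a₀) ⟩
        ((a₁ * p + a₀) + p) C b₀  ≈⟨ [m+p]Cn≡mCn (a₁ * p + a₀) b₀ b₀<p ⟩
        (a₁ * p + a₀) C b₀        ≈⟨ go a₁ zero ⟩
        (a₀ C b₀) * 1             ∎
      go (suc a₁) (suc b₁) = begin
        (suc a₁ * p + a₀) C (suc b₁ * p + b₀)          ≡⟨ cong₂ _C_ (shift a₁ a₀) (shift b₁ b₀) ⟩
        (x + p) C (y + p)                              ≈⟨ [m+p]C[n+p]≡mC[n+p]+mCn x y ⟩
        x C (y + p) + x C y                            ≡⟨ cong (λ z → x C z + x C y) (shift b₁ b₀) ⟨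
        x C (suc b₁ * p + b₀) + x C y                  ≈⟨ +-cong-≡[] (go a₁ (suc b₁)) (go a₁ b₁) ⟩
        (a₀ C b₀) * (a₁ C suc b₁) + (a₀ C b₀) * (a₁ C b₁)  ≡⟨ +-comm ((a₀ C b₀) * (a₁ C suc b₁)) _ ⟩
        (a₀ C b₀) * (a₁ C b₁) + (a₀ C b₀) * (a₁ C suc b₁)  ≡⟨ *-distribˡ-+ (a₀ C b₀) (a₁ C b₁) _ ⟨
        (a₀ C b₀) * (a₁ C b₁ + a₁ C suc b₁)            ≡⟨ cong ((a₀ C b₀) *_) (pascal a₁ (suc b₁)) ⟨
        (a₀ C b₀) * (suc a₁ C suc b₁)                  ∎
        where
        x = a₁ * p + a₀
        y = b₁ * p + b₀

    lucas : ∀ n k → n C k ≡[ p ] (n % p C k % p) * (n / p C k / p)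
    lucas n k = subst₂ (λ n′ k′ → n′ C k′ ≡[ p ] (n % p C k % p) * (n / p C k / p))
      (sym (divMod n)) (sym (divMod k)) (lucas-digits (m%n<n n p) (m%n<n k p) (n / p) (k / p))
      where
      divMod : ∀ m → m ≡ m / p * p + m % p
      divMod m = trans (m≡m%n+[m/n]*n m p) (+-comm (m % p) _)

  lucas-noCarry₀ : ∀ a b → a % p + b % p < p →
    (a + b) C b ≡[ p ] ((a % p + b % p) C b % p) * ((a / p + b / p) C b / p)
  lucas-noCarry₀ a b a₀+b₀<p =
    subst₂ (λ s q → (a + b) C b ≡[ p ] (s C b % p) * (q C b / p)) [a+b]%p≡a₀+b₀ (+-distrib-/ a b a₀+b₀<p)
      (lucas (a + b) b)
    where
    [a+b]%p≡a₀+b₀ : (a + b) % p ≡ a % p + b % p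
    [a+b]%p≡a₀+b₀ = trans (%-distribˡ-+ a b p) (m<n⇒m%n≡m a₀+b₀<p)

  carry⇒p∣[a+b]Cb : ∀ {a b} → p ≤ a % p + b % p → p ∣ (a + b) C b
  carry⇒p∣[a+b]Cb {a} {b} p≤a₀+b₀ = ∣-resp-≡[] (≡[]-sym (lucas (a + b) b))
    (subst (λ x → p ∣ x * ((a + b) / p C b / p)) (sym (k>n⇒nCk≡0 [a+b]%p<b%p)) (p ∣0))
    where
    a₀+b₀ = a % p + b % p
    a₀+b₀∸p<b₀ : a₀+b₀ ∸ p < b % p
    a₀+b₀∸p<b₀ = subst (a₀+b₀ ∸ p <_) (m+n∸m≡n p (b % p))
      (∸-monoˡ-< (+-monoˡ-< (b % p) (m%n<n a p)) p≤a₀+b₀)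
    [a+b]%p<b%p : (a + b) % p < b % p
    [a+b]%p<b%p = subst (_< b % p) [a+b]%p≡a₀+b₀∸p a₀+b₀∸p<b₀
      where
      [a+b]%p≡a₀+b₀∸p : a₀+b₀ ∸ p ≡ (a + b) % p
      [a+b]%p≡a₀+b₀∸p = sym (trans (%-distribˡ-+ a b p) (trans (sym (m≤n⇒[n∸m]%m≡n%m p≤a₀+b₀))
        (m<n⇒m%n≡m (<-trans a₀+b₀∸p<b₀ (m%n<n b p)))))

  noCarry⇒p∤[a+b]Cb : ∀ {a b} → NoCarry p a b → ¬ p ∣ (a + b) C b
  noCarry⇒p∤[a+b]Cb {a} {b} = go a b (<-wellFounded b)
    where
    go : ∀ a b → Acc _<_ b → NoCarry p a b → ¬ p ∣ (a + b) C b
    go a zero          _         _  = p∤1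
    go a b@(suc _) (acc rec) nc p∣C =
      [ n<p⇒p∤nCk a₀+b₀<p (m≤n+m (b % p) (a % p))
      , go (a / p) (b / p) (rec (m/n<m b p 1<p)) (noCarry-/ p nc)
      ]′ (euclidsLemma _ _ p-prime (∣-resp-≡[] (lucas-noCarry₀ a b a₀+b₀<p) p∣C))
      where
      a₀+b₀<p = noCarry⇒%<p p nc

  p∤[a+b]Cb⇒noCarry : ∀ {a b} → ¬ p ∣ (a + b) C b → NoCarry p a b
  p∤[a+b]Cb⇒noCarry {a} {b} p∤C zero    =
    subst (_< p) (sym (cong₂ _+_ (digit-zero p a) (digit-zero p b))) a₀+b₀<p
    where a₀+b₀<p = ≰⇒> (p∤C ∘ carry⇒p∣[a+b]Cb)
  p∤[a+b]Cb⇒noCarry {a} {b} p∤C (suc e) =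
    subst (_< p) (sym (cong₂ _+_ (digit-suc p a e) (digit-suc p b e))) (p∤[a+b]Cb⇒noCarry p∤high e)
    where
    a₀+b₀<p = ≰⇒> (p∤C ∘ carry⇒p∣[a+b]Cb)
    p∤high : ¬ p ∣ (a / p + b / p) C b / p
    p∤high p∣high = p∤C (∣-resp-≡[] (≡[]-sym (lucas-noCarry₀ a b a₀+b₀<p))
      (∣-trans p∣high (n∣m*n ((a % p + b % p) C b % p))))

  noCarry⇒laguerre-colemanIntegral : ∀ {n r} → NoCarry p n r → ColemanIntegral p n (laguerreCoeff n r)
  noCarry⇒laguerre-colemanIntegral {n} {r} nc =
    aₙ≢0 , (λ j _ → p∤denominator j) , λ k k∈ → p∤numerator k∈ , p∤denominator k
    where
    p∤denominator : ∀ j → ¬ p ∣ ↧ₙ laguerreCoeff n r j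
    p∤denominator j = p∤1 ∘ subst (p ∣_) (laguerreCoeff-denominator n r j)
    aₙ≢0 : laguerreCoeff n r n ≢ 0ℚ
    aₙ≢0 aₙ≡0 = contradiction (subst (λ m → (m + r) C m ≡ 0) (n∸n≡0 n)
      (trans (sym (laguerreCoeff-numerator n r n)) (cong (∣_∣ ∘ ↥_) aₙ≡0))) (λ ())
    p∤numerator : ∀ {k} → k ∈ pivotalIndices p n → ¬ p ∣ ∣ ↥ laguerreCoeff n r k ∣
    p∤numerator {k} k∈ with ∈-pivotalIndices⇒∸≡lastDigits p n 1<p k∈
    ... | e , n∸k≡m = noCarry⇒p∤[a+b]Cb (noCarry-lastDigits p e nc) ∘ subst (p ∣_) (begin
      ∣ ↥ laguerreCoeff n r k ∣  ≡⟨ laguerreCoeff-numerator n r k ⟩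
      (n ∸ k + r) C (n ∸ k)      ≡⟨ cong (λ m → (m + r) C m) n∸k≡m ⟩
      (m + r) C m                ≡⟨ [m+n]Cm≡[m+n]Cn m r ⟩
      (m + r) C r                ∎)
      where
      open ≡-Reasoning
      m = lastDigits p e n

  laguerre-colemanIntegral⇒p∤[n+r]Cr : ∀ {n r} → ColemanIntegral p n (laguerreCoeff n r) → ¬ p ∣ (n + r) C r
  laguerre-colemanIntegral⇒p∤[n+r]Cr {n} {r} (_ , _ , pivotal-unit) =
    proj₁ (pivotal-unit 0 (head∈scanl _+_ 0 _))
      ∘ subst (p ∣_) (sym (trans (laguerreCoeff-numerator n r 0) ([m+n]Cm≡[m+n]Cn n r)))

lemma2p9 : (n r p : ℕ) → 1 ≤ n → (pp : Prime p) →
    ((p ∣ n) →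
      (ColemanIntegral p {{prime⇒nonZero pp}} n (laguerreCoeff n r)
        ⇔ (¬ (p ∣ ((n + r) C r)))))
    × ((Σ ℕ λ k → OrdIs p (r !) k × (p ^ suc k ∣ n)) →
      ColemanIntegral p {{prime⇒nonZero pp}} n (laguerreCoeff n r))
lemma2p9 n r p _ pp =
  (λ _ → mk⇔ (laguerre-colemanIntegral⇒p∤[n+r]Cr pp)
             (noCarry⇒laguerre-colemanIntegral pp ∘ p∤[a+b]Cb⇒noCarry pp))
  , λ (k , (_ , p^[1+k]∤r!) , p^[1+k]∣n) →
      noCarry⇒laguerre-colemanIntegral pp
        (noCarry-separated p (suc k) p^[1+k]∣n (m∤n!⇒n<m r {{m^n≢0 p (suc k)}} p^[1+k]∤r!))
  where instance _ = prime⇒nonZero pp
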